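{- Let $\mathbb A=(A,+)$ be a group and let $X,Y$ be non-empty subsets of $A$ such that $\langle Y\rangle$ is commutative. Then $|X+Y|\ge\min(\omega(Y),|X|+|Y|-1)$, where $\omega(Y)=\sup_{y_0\in Y}\inf_{y\in Y\setminus\{y_0\}}\mathrm{ord}(y-y_0)$; moreover, if $Y$ is finite, then $\omega(Y)=\max_{y_0\in Y}\inf_{y\in Y\setminus\{y_0\}}\mathrm{ord}(y-y_0)$.
   Context: The group is written additively and need not be commutative. $X+Y:=\{x+y:x\in X,y\in Y\}$; $\langle Y\rangle$ is the subsemigroup generated by $Y$; $\mathrm{ord}(z)$ is the cardinality of the subsemigroup generated by $z$; $y-y_0$ denotes $y$ plus the inverse of $y_0$. In general, for a semigroup, $\omega(Y):=\sup_{y_0\in Y\cap A^\times}\inf_{y\in Y\setminus\{y_0\}}\mathrm{ord}(y-y_0)$ where $A^\times$ is the set of units, with the conventions $\sup\emptyset=0$ and $\inf\emptyset=|\mathbb N|$. -}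

module Defs where

open import Level using (Level; _⊔_) renaming (suc to lsuc)
open import Algebra.Bundles using (Group)
open import Data.Nat using (ℕ; _≤_; _+_; _∸_)
open import Data.Fin using (Fin)
open import Data.List using (List)
open import Data.List.Relation.Unary.Any using (Any)
open import Data.Product using (Σ; ∃; _×_; ∃-syntax)
open import Data.Sum using (_⊎_)
open import Relation.Nullary using (¬_)
open import Relation.Unary using (Pred)
open import Relation.Binary.PropositionalEquality using (_≡_)

-- Definitions relative to a group G = (A, ∙). Equality in A is the
-- setoid equality _≈_ of the bundle; subsets of A are predicates,
-- and cardinalities count elements up to _≈_.
module GroupDefs {c ℓ} (G : Group c ℓ) where
  open Group G

  _⊕_ : ∀ {p q} → Pred Carrier p → Pred Carrier q → Pred Carrier (c ⊔ ℓ ⊔ p ⊔ q)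
  (X ⊕ Y) a = ∃[ x ] ∃[ y ] (X x × Y y × a ≈ x ∙ y)

  data ⟨_⟩ {p} (Y : Pred Carrier p) : Pred Carrier (c ⊔ p) where
    gen : ∀ {a} → Y a → ⟨ Y ⟩ a
    add : ∀ {a b} → ⟨ Y ⟩ a → ⟨ Y ⟩ b → ⟨ Y ⟩ (a ∙ b)

  Commutative : ∀ {p} → Pred Carrier p → Set (c ⊔ ℓ ⊔ p)
  Commutative S = ∀ {a b} → S a → S b → a ∙ b ≈ b ∙ a

  -- |S| ≥ n : S contains n pairwise distinct elements
  AtLeast : ∀ {p} → Pred Carrier p → ℕ → Set (c ⊔ ℓ ⊔ p)
  AtLeast S n = Σ (Fin n → Carrier) λ f →
                  (∀ i → S (f i)) × (∀ i j → f i ≈ f j → i ≡ j)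

  ｛_｝ : Carrier → Pred Carrier ℓ
  ｛ z ｝ a = a ≈ z

  -- ord(z) ≥ n, where ord(z) = |⟨ z ⟩|
  OrdAtLeast : Carrier → ℕ → Set (c ⊔ ℓ)
  OrdAtLeast z n = AtLeast ⟨ ｛ z ｝ ⟩ n

  -- inf_{y ∈ Y \ {y0}} ord(y - y0) ≥ n   (inf ∅ = |ℕ|)
  InfAtLeast : ∀ {p} → Pred Carrier p → Carrier → ℕ → Set (c ⊔ ℓ ⊔ p)
  InfAtLeast Y y₀ n = ∀ y → Y y → ¬ (y ≈ y₀) → OrdAtLeast (y ∙ y₀ ⁻¹) n

  -- ω(Y) ≥ n, where ω(Y) = sup_{y0 ∈ Y} inf_{y ∈ Y\{y0}} ord(y - y0)
  -- (sup ∅ = 0; for finite n, "sup ≥ n" means n = 0 or some term is ≥ n)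
  ωAtLeast : ∀ {p} → Pred Carrier p → ℕ → Set (c ⊔ ℓ ⊔ p)
  ωAtLeast Y n = n ≡ 0 ⊎ ∃[ y₀ ] (Y y₀ × InfAtLeast Y y₀ n)

  -- |X| + |Y| - 1 ≥ n  (for non-empty X, Y)
  SumAtLeast : ∀ {p q} → Pred Carrier p → Pred Carrier q → ℕ → Set (c ⊔ ℓ ⊔ p ⊔ q)
  SumAtLeast X Y n = ∃[ a ] ∃[ b ] (AtLeast X a × AtLeast Y b × n ≤ a + b ∸ 1)

  Finite : ∀ {p} → Pred Carrier p → Set (c ⊔ ℓ ⊔ p)
  Finite Y = ∃[ ys ] (∀ {a} → Y a → Any (a ≈_) ys)

  NonEmpty : ∀ {p} → Pred Carrier p → Set (c ⊔ p)
  NonEmpty X = ∃[ x ] X x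

-- After translating Y by −y₀ we may assume 0 ∈ Y, and, keeping only the
-- elements witnessing |X| ≥ a and |Y| ≥ b, that X and Y are finite. Induct on
-- |Y| with a Chowla-type transform: if z ∈ Y, z ≠ 0, and x ∈ X with x + z ∉ X,
-- replace Y by Y′ = {w ∈ Y : x + w ∈ X} and X by X ∪ (x + (Y ∖ Y′)). This
-- keeps 0 ∈ Y′ and |X| + |Y|, shrinks Y (z ∉ Y′), and, Y being commutative,
-- gives X′ + Y′ ⊆ X + Y. The induction ends when Y = {0}, where X ⊆ X + Y,
-- or when X + z ⊆ X for some z ≠ 0, where x + ⟨z⟩ ⊆ X ⊆ X + Y supplies
-- ord(z) ≥ n elements.
-- For finite Y the supremum in ω(Y) is attained: the values
-- inf_{y ≠ y₀} ord(y − y₀), seen as down-closed predicates on ℕ, are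
-- classically totally preordered, and a finite set has a greatest element.
module Submission where

open import Defs
open import Level using (_⊔_)
open import Algebra.Bundles using (Group)
open import Axiom.ExcludedMiddle using (ExcludedMiddle)
open import Data.Nat using (ℕ; suc; _≤_; _<_; _+_; _∸_; z≤n; s≤s)
open import Data.Nat.Properties
  using (≤-refl; ≤-trans; ≤-reflexive; ≤-total; n≤1+n; +-suc; +-mono-≤; +-monoʳ-≤;
         ∸-monoˡ-≤; m+n∸n≡m; +-assoc; +-comm; module ≤-Reasoning)
open import Data.Nat.Induction using (<-wellFounded)
open import Induction.WellFounded using (Acc; acc)
open import Data.Fin using (zero; suc; inject≤)
open import Data.Fin.Properties using (inject≤-injective)
open import Data.List using (List; []; _∷_; length; map; filter; tabulate; lookup; _++_)
open import Data.List.Properties using (length-++; length-map; length-tabulate)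
open import Data.List.Relation.Unary.All as All using (All; []; _∷_)
import Data.List.Relation.Unary.All.Properties as All
open import Data.List.Relation.Unary.Any as Any using (Any; here; there)
import Data.List.Membership.Propositional.Properties as ∈ₚ
open import Data.Product using (_×_; _,_; proj₁; proj₂; ∃-syntax)
open import Data.Sum using (_⊎_; inj₁; inj₂)
open import Data.Empty using (⊥-elim)
open import Function.Base using (_on_; _∘_)
open import Function.Bundles using (_⇔_; mk⇔)
open import Relation.Nullary using (¬_; yes; no)
open import Relation.Nullary.Decidable using (decidable-stable)
open import Relation.Unary using (Pred; Decidable; _⊆′_)
open import Relation.Unary.Properties using (∁?)
open import Relation.Binary.Definitions using (Reflexive; Transitive; Total)
open import Relation.Binary.Core using (Rel)
open import Relation.Binary.PropositionalEquality using (_≡_; refl; cong; subst; module ≡-Reasoning)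
  renaming (trans to ≡-trans; sym to ≡-sym)

module _ {a p} {A : Set a} {P : Pred A p} (P? : Decidable P) where

  length-filter-∁ : ∀ xs → length (filter P? xs) + length (filter (∁? P?) xs) ≡ length xs
  length-filter-∁ [] = refl
  length-filter-∁ (x ∷ xs) with P? x
  ... | yes _ = cong suc (length-filter-∁ xs)
  ... | no _  = ≡-trans (+-suc _ _) (cong suc (length-filter-∁ xs))

Downward : ∀ {p} → Pred ℕ p → Set p
Downward P = ∀ {m n} → m ≤ n → P n → P m

downward-total : (em : ∀ {a} → ExcludedMiddle a) →
                 ∀ {p q} {P : Pred ℕ p} {Q : Pred ℕ q} →
                 Downward P → Downward Q → P ⊆′ Q ⊎ Q ⊆′ P
downward-total em {P = P} {Q} P↓ Q↓ with em {P = ∃[ n ] (P n × ¬ Q n)}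
... | no ∄ = inj₁ λ n Pn → decidable-stable em λ ¬Qn → ∄ (n , Pn , ¬Qn)
... | yes (n , Pn , ¬Qn) = inj₂ Q⊆P
  where
  Q⊆P : Q ⊆′ P
  Q⊆P m Qm with ≤-total m n
  ... | inj₁ m≤n = P↓ m≤n Pn
  ... | inj₂ n≤m = ⊥-elim (¬Qn (Q↓ n≤m Qm))

module _ {a r} {A : Set a} {_≲_ : Rel A r}
         (≲-refl : Reflexive _≲_) (≲-trans : Transitive _≲_) (≲-total : Total _≲_) where

  ∃-greatest : ∀ x xs → ∃[ m ] All (_≲ m) (x ∷ xs)
  ∃-greatest x [] = x , ≲-refl ∷ []
  ∃-greatest x (y ∷ ys) with ∃-greatest y ys
  ... | m , ys≲m with ≲-total x m
  ...   | inj₁ x≲m = m , x≲m ∷ ys≲m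
  ...   | inj₂ m≲x = x , ≲-refl ∷ All.map (λ w≲m → ≲-trans w≲m m≲x) ys≲m

module Sumsets {c ℓ} (G : Group c ℓ) where
  open Group G renaming (refl to ≈-refl)
  open GroupDefs G
  open import Algebra.Properties.Group G using (∙-cancelˡ; ∙-cancelʳ)
  import Relation.Binary.Reasoning.Setoid setoid as ≈-Reasoning
  open import Data.List.Membership.Setoid setoid using (_∈_; _∉_)
  open import Data.List.Membership.Setoid.Properties
    using (∈-resp-≈; ∈-map⁺; ∈-map⁻; ∈-++⁺ˡ; ∈-++⁻; ∈-filter⁺; ∈-filter⁻; ∈-length; ∈-lookup; ∉⇒All[≉])
  open import Data.List.Relation.Unary.Unique.Setoid setoid using (Unique; []; _∷_)
  import Data.List.Relation.Unary.Unique.Setoid.Properties as Unique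

  AtLeast-zero : ∀ {p} {P : Pred Carrier p} → AtLeast P 0
  AtLeast-zero = (λ ()) , (λ ()) , (λ ())

  AtLeast-≤ : ∀ {p} {P : Pred Carrier p} {m n} → m ≤ n → AtLeast P n → AtLeast P m
  AtLeast-≤ m≤n (f , Pf , f-inj) =
    (λ i → f (inject≤ i m≤n)) , (λ i → Pf (inject≤ i m≤n)) ,
    (λ i j eq → inject≤-injective m≤n m≤n i j (f-inj _ _ eq))

  AtLeast-image : ∀ {p q} {P : Pred Carrier p} {Q : Pred Carrier q} {n} (g : Carrier → Carrier) →
                  (∀ {a b} → g a ≈ g b → a ≈ b) → (∀ {a} → P a → Q (g a)) →
                  AtLeast P n → AtLeast Q n
  AtLeast-image g g-inj P⇒Q (f , Pf , f-inj) =
    (λ i → g (f i)) , (λ i → P⇒Q (Pf i)) , (λ i j eq → f-inj i j (g-inj eq))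

  AtLeast-map : ∀ {p q} {P : Pred Carrier p} {Q : Pred Carrier q} {n} →
                (∀ {a} → P a → Q a) → AtLeast P n → AtLeast Q n
  AtLeast-map = AtLeast-image (λ a → a) (λ eq → eq)

  ⟨｛｝⟩-resp-≈ : ∀ {z z′ a} → z ≈ z′ → ⟨ ｛ z ｝ ⟩ a → ⟨ ｛ z′ ｝ ⟩ a
  ⟨｛｝⟩-resp-≈ z≈z′ (gen a≈z) = gen (trans a≈z z≈z′)
  ⟨｛｝⟩-resp-≈ z≈z′ (add p q) = add (⟨｛｝⟩-resp-≈ z≈z′ p) (⟨｛｝⟩-resp-≈ z≈z′ q)

  OrdAtLeast-resp-≈ : ∀ {z z′ n} → z ≈ z′ → OrdAtLeast z n → OrdAtLeast z′ n
  OrdAtLeast-resp-≈ {z} z≈z′ = AtLeast-map {P = ⟨ ｛ z ｝ ⟩} (⟨｛｝⟩-resp-≈ z≈z′)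

  lookup≈ : ∀ {p} {P : Pred Carrier p} {xs a} → All P xs → a ∈ xs → ∃[ b ] (P b × a ≈ b)
  lookup≈ Pxs a∈xs = Any.lookup a∈xs , All.lookupAny Pxs a∈xs

  lookup-injective : ∀ {xs} → Unique xs → ∀ i j → lookup xs i ≈ lookup xs j → i ≡ j
  lookup-injective (_ ∷ _) zero zero _ = refl
  lookup-injective (x≉xs ∷ _) zero (suc j) eq = ⊥-elim (All.lookup x≉xs (∈ₚ.∈-lookup j) eq)
  lookup-injective (x≉xs ∷ _) (suc i) zero eq = ⊥-elim (All.lookup x≉xs (∈ₚ.∈-lookup i) (sym eq))
  lookup-injective (_ ∷ xs!) (suc i) (suc j) eq = cong suc (lookup-injective xs! i j eq)

  Unique⇒AtLeast : ∀ {xs} → Unique xs → AtLeast (_∈ xs) (length xs)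
  Unique⇒AtLeast {xs} xs! = lookup xs , ∈-lookup setoid xs , lookup-injective xs!

  AtLeast⇒Unique : ∀ {p} {P : Pred Carrier p} {n} → AtLeast P n →
                   ∃[ xs ] (Unique xs × All P xs × length xs ≡ n)
  AtLeast⇒Unique (f , Pf , f-inj) =
    tabulate f , Unique.tabulate⁺ setoid (f-inj _ _) , All.tabulate⁺ Pf , length-tabulate f

  length≤1 : ∀ {xs b} → Unique xs → (∀ {a} → a ∈ xs → a ≈ b) → length xs ≤ 1
  length≤1 {[]} _ _ = z≤n
  length≤1 {_ ∷ []} _ _ = s≤s z≤n
  length≤1 {_ ∷ _ ∷ _} ((x≉y ∷ _) ∷ _) all≈b =
    ⊥-elim (x≉y (trans (all≈b (here ≈-refl)) (sym (all≈b (there (here ≈-refl))))))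

  Commute : Rel Carrier ℓ
  Commute a b = a ∙ b ≈ b ∙ a

  commute-∙ : ∀ {a b c} → Commute a b → Commute a c → Commute a (b ∙ c)
  commute-∙ {a} {b} {c} ab ac = begin
    a ∙ (b ∙ c)  ≈⟨ assoc a b c ⟨
    (a ∙ b) ∙ c  ≈⟨ ∙-congʳ ab ⟩
    (b ∙ a) ∙ c  ≈⟨ assoc b a c ⟩
    b ∙ (a ∙ c)  ≈⟨ ∙-congˡ ac ⟩
    b ∙ (c ∙ a)  ≈⟨ assoc b c a ⟨
    (b ∙ c) ∙ a  ∎
    where open ≈-Reasoning

  commute-⁻¹ : ∀ {a b} → Commute a b → Commute a (b ⁻¹)
  commute-⁻¹ {a} {b} ab = ∙-cancelˡ b _ _ (begin
    b ∙ (a ∙ b ⁻¹)  ≈⟨ assoc b a (b ⁻¹) ⟨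
    (b ∙ a) ∙ b ⁻¹  ≈⟨ ∙-congʳ ab ⟨
    (a ∙ b) ∙ b ⁻¹  ≈⟨ assoc a b (b ⁻¹) ⟩
    a ∙ (b ∙ b ⁻¹)  ≈⟨ ∙-congˡ (inverseʳ b) ⟩
    a ∙ ε           ≈⟨ identityʳ a ⟩
    a               ≈⟨ identityˡ a ⟨
    ε ∙ a           ≈⟨ ∙-congʳ (inverseʳ b) ⟨
    (b ∙ b ⁻¹) ∙ a  ≈⟨ assoc b (b ⁻¹) a ⟩
    b ∙ (b ⁻¹ ∙ a)  ∎)
    where open ≈-Reasoning

  commute-difference : ∀ {y₀ y₁ y₂} → Commute y₁ y₂ → Commute y₀ y₁ → Commute y₀ y₂ →
                       Commute (y₁ ∙ y₀ ⁻¹) (y₂ ∙ y₀ ⁻¹)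
  commute-difference c₁₂ c₀₁ c₀₂ = commute-∙
    (sym (commute-∙ (sym c₁₂) (commute-⁻¹ (sym c₀₂))))
    (sym (commute-∙ (sym (commute-⁻¹ (sym c₀₁))) ≈-refl))

  infixl 6 _⊕ₗ_
  _⊕ₗ_ : List Carrier → List Carrier → Pred Carrier (c ⊔ ℓ)
  xs ⊕ₗ zs = (_∈ xs) ⊕ (_∈ zs)

  ∈⇒∈⊕ₗ : ∀ {xs zs a} → ε ∈ zs → a ∈ xs → (xs ⊕ₗ zs) a
  ∈⇒∈⊕ₗ ε∈zs a∈xs = _ , ε , a∈xs , ε∈zs , sym (identityʳ _)

  ⟨｛｝⟩-closed : ∀ {xs z} → (∀ {x} → x ∈ xs → x ∙ z ∈ xs) →
                 ∀ {a x} → ⟨ ｛ z ｝ ⟩ a → x ∈ xs → x ∙ a ∈ xs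
  ⟨｛｝⟩-closed closed (gen a≈z) x∈xs = ∈-resp-≈ setoid (∙-congˡ (sym a≈z)) (closed x∈xs)
  ⟨｛｝⟩-closed closed (add p q) x∈xs =
    ∈-resp-≈ setoid (assoc _ _ _) (⟨｛｝⟩-closed closed q (⟨｛｝⟩-closed closed p x∈xs))

  record Admissible (n : ℕ) (zs : List Carrier) : Set (c ⊔ ℓ) where
    field
      unique    : Unique zs
      ε∈        : ε ∈ zs
      commuting : ∀ {a b} → a ∈ zs → b ∈ zs → Commute a b
      ord≥      : ∀ {z} → z ∈ zs → z ≉ ε → OrdAtLeast z n

  ∈-differences : ∀ {q} {Y : Pred Carrier q} {ys y₀ a} → All Y ys → a ∈ map (_∙ y₀ ⁻¹) ys →
                  ∃[ y ] (Y y × a ≈ y ∙ y₀ ⁻¹)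
  ∈-differences Yys a∈ with ∈-map⁻ setoid setoid a∈
  ... | u , u∈ys , a≈ with lookup≈ Yys u∈ys
  ... | y , Yy , u≈y = y , Yy , trans a≈ (∙-congʳ u≈y)

  differences-admissible : ∀ {q} {Y : Pred Carrier q} {ys y₀ n} → Unique ys → All Y ys → y₀ ∈ ys →
                           Y y₀ → Commutative ⟨ Y ⟩ → InfAtLeast Y y₀ n →
                           Admissible n (map (_∙ y₀ ⁻¹) ys)
  differences-admissible {Y = Y} {ys} {y₀} {n} ys! Yys y₀∈ys Yy₀ comm inf = record
    { unique    = Unique.map⁺ setoid setoid (∙-cancelʳ (y₀ ⁻¹) _ _) ys!
    ; ε∈        = ∈-resp-≈ setoid (inverseʳ y₀) (∈-map⁺ setoid setoid ∙-congʳ y₀∈ys)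
    ; commuting = commuting
    ; ord≥      = ord≥
    }
    where
    commuting : ∀ {a b} → a ∈ map (_∙ y₀ ⁻¹) ys → b ∈ map (_∙ y₀ ⁻¹) ys → Commute a b
    commuting a∈ b∈ with ∈-differences Yys a∈ | ∈-differences Yys b∈
    ... | y₁ , Yy₁ , a≈ | y₂ , Yy₂ , b≈ =
      trans (∙-cong a≈ b≈)
        (trans (commute-difference (comm (gen Yy₁) (gen Yy₂)) (comm (gen Yy₀) (gen Yy₁))
                                   (comm (gen Yy₀) (gen Yy₂)))
               (sym (∙-cong b≈ a≈)))
    ord≥ : ∀ {z} → z ∈ map (_∙ y₀ ⁻¹) ys → z ≉ ε → OrdAtLeast z n
    ord≥ z∈ z≉ε with ∈-differences Yys z∈
    ... | y , Yy , z≈ = OrdAtLeast-resp-≈ (sym z≈)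
      (inf y Yy λ y≈y₀ → z≉ε (trans z≈ (trans (∙-congʳ y≈y₀) (inverseʳ y₀))))

  ⊕ₗ-bound-trivial : ∀ {n xs zs} → Unique xs → Admissible n zs → (∀ {z} → z ∈ zs → z ≈ ε) →
                     n ≤ length xs + length zs ∸ 1 → AtLeast (xs ⊕ₗ zs) n
  ⊕ₗ-bound-trivial {n} {xs} {zs} xs! adm zs≈ε n≤ =
    AtLeast-map {P = _∈ xs} {Q = xs ⊕ₗ zs} (∈⇒∈⊕ₗ ε∈)
                (AtLeast-≤ {P = _∈ xs} n≤|xs| (Unique⇒AtLeast xs!))
    where
    open Admissible adm
    n≤|xs| : n ≤ length xs
    n≤|xs| = ≤-trans n≤ (≤-trans (∸-monoˡ-≤ 1 (+-monoʳ-≤ (length xs) (length≤1 unique zs≈ε)))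
                                 (≤-reflexive (m+n∸n≡m (length xs) 1)))

  ⊕ₗ-bound-periodic : ∀ {n xs zs x₀ z} → x₀ ∈ xs → ε ∈ zs → (∀ {x} → x ∈ xs → x ∙ z ∈ xs) →
                      OrdAtLeast z n → AtLeast (xs ⊕ₗ zs) n
  ⊕ₗ-bound-periodic {xs = xs} {zs} {x₀} {z} x₀∈xs ε∈zs periodic =
    AtLeast-image {P = ⟨ ｛ z ｝ ⟩} {Q = xs ⊕ₗ zs} (x₀ ∙_) (∙-cancelˡ x₀ _ _)
                  (λ a∈⟨z⟩ → ∈⇒∈⊕ₗ ε∈zs (⟨｛｝⟩-closed periodic a∈⟨z⟩ x₀∈xs))

  module WithExcludedMiddle (em : ∀ {a} → ExcludedMiddle a) where

    module Transform (x : Carrier) (xs zs : List Carrier) where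

      Lands : Pred Carrier (c ⊔ ℓ)
      Lands w = x ∙ w ∈ xs

      lands? : Decidable Lands
      lands? _ = em

      lands-resp-≈ : ∀ {v w} → v ≈ w → Lands v → Lands w
      lands-resp-≈ v≈w = ∈-resp-≈ setoid (∙-congˡ v≈w)

      ∉-lands-resp-≈ : ∀ {v w} → v ≈ w → ¬ Lands v → ¬ Lands w
      ∉-lands-resp-≈ v≈w ¬lands = ¬lands ∘ lands-resp-≈ (sym v≈w)

      kept moved xs′ : List Carrier
      kept  = filter lands? zs
      moved = filter (∁? lands?) zs
      xs′   = xs ++ map (x ∙_) moved

      kept⊆zs : ∀ {w} → w ∈ kept → w ∈ zs
      kept⊆zs w∈ = proj₁ (∈-filter⁻ setoid lands? lands-resp-≈ {xs = zs} w∈)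

      admissible-kept : ∀ {n} → x ∈ xs → Admissible n zs → Admissible n kept
      admissible-kept x∈xs adm = record
        { unique    = Unique.filter⁺ setoid lands? unique
        ; ε∈        = ∈-filter⁺ setoid lands? lands-resp-≈ ε∈
                        (∈-resp-≈ setoid (sym (identityʳ x)) x∈xs)
        ; commuting = λ a∈ b∈ → commuting (kept⊆zs a∈) (kept⊆zs b∈)
        ; ord≥      = λ z∈ → ord≥ (kept⊆zs z∈)
        }
        where open Admissible adm

      unique-xs′ : Unique xs → Unique zs → Unique xs′
      unique-xs′ xs! zs! =
        Unique.++⁺ setoid xs!
          (Unique.map⁺ setoid setoid (∙-cancelˡ x _ _) (Unique.filter⁺ setoid (∁? lands?) zs!))
          disjoint
        where
        disjoint : ∀ {v} → ¬ (v ∈ xs × v ∈ map (x ∙_) moved)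
        disjoint (v∈xs , v∈moved) with ∈-map⁻ setoid setoid v∈moved
        ... | u , u∈moved , v≈xu =
          proj₂ (∈-filter⁻ setoid (∁? lands?) ∉-lands-resp-≈ {xs = zs} u∈moved)
                (∈-resp-≈ setoid v≈xu v∈xs)

      length-xs′ : length xs′ ≡ length xs + length moved
      length-xs′ = ≡-trans (length-++ xs) (cong (length xs +_) (length-map (x ∙_) moved))

      length-transform : length xs′ + length kept ≡ length xs + length zs
      length-transform = begin
        length xs′ + length kept                  ≡⟨ cong (_+ length kept) length-xs′ ⟩
        length xs + length moved + length kept    ≡⟨ +-assoc (length xs) _ _ ⟩
        length xs + (length moved + length kept)  ≡⟨ cong (length xs +_) (+-comm (length moved) _) ⟩
        length xs + (length kept + length moved)  ≡⟨ cong (length xs +_) (length-filter-∁ lands? zs) ⟩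
        length xs + length zs                     ∎
        where open ≡-Reasoning

      kept-shorter : ∀ {z} → z ∈ zs → ¬ Lands z → length kept < length zs
      kept-shorter z∈zs ¬lands = begin
        suc (length kept)             ≡⟨ +-comm 1 (length kept) ⟩
        length kept + 1               ≤⟨ +-monoʳ-≤ (length kept) (∈-length setoid z∈moved) ⟩
        length kept + length moved    ≡⟨ length-filter-∁ lands? zs ⟩
        length zs                     ∎
        where
        open ≤-Reasoning
        z∈moved : _ ∈ moved
        z∈moved = ∈-filter⁺ setoid (∁? lands?) ∉-lands-resp-≈ z∈zs ¬lands

      ⊕ₗ-transform-⊆ : (∀ {a b} → a ∈ zs → b ∈ zs → Commute a b) →
                       ∀ {w} → (xs′ ⊕ₗ kept) w → (xs ⊕ₗ zs) w
      ⊕ₗ-transform-⊆ commuting {w} (x′ , z′ , x′∈ , z′∈ , w≈) with ∈-++⁻ setoid xs x′∈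
      ... | inj₁ x′∈xs = x′ , z′ , x′∈xs , kept⊆zs z′∈ , w≈
      ... | inj₂ x′∈map with ∈-map⁻ setoid setoid x′∈map
      ...   | u , u∈moved , x′≈xu = x ∙ z′ , u , x∙z′∈xs , u∈zs , (begin
        w              ≈⟨ w≈ ⟩
        x′ ∙ z′        ≈⟨ ∙-congʳ x′≈xu ⟩
        (x ∙ u) ∙ z′   ≈⟨ assoc x u z′ ⟩
        x ∙ (u ∙ z′)   ≈⟨ ∙-congˡ (commuting u∈zs (kept⊆zs z′∈)) ⟩
        x ∙ (z′ ∙ u)   ≈⟨ assoc x z′ u ⟨
        (x ∙ z′) ∙ u   ∎)
        where
        open ≈-Reasoning
        x∙z′∈xs : Lands z′
        x∙z′∈xs = proj₂ (∈-filter⁻ setoid lands? lands-resp-≈ {xs = zs} z′∈)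
        u∈zs : u ∈ zs
        u∈zs = proj₁ (∈-filter⁻ setoid (∁? lands?) ∉-lands-resp-≈ {xs = zs} u∈moved)

    ⊕ₗ-bound : ∀ {n xs zs x₀} → Acc _<_ (length zs) → Unique xs → x₀ ∈ xs → Admissible n zs →
               n ≤ length xs + length zs ∸ 1 → AtLeast (xs ⊕ₗ zs) n
    ⊕ₗ-bound {n} {xs} {zs} (acc rec) xs! x₀∈xs adm n≤ with em {P = ∃[ z ] (z ∈ zs × z ≉ ε)}
    ... | no ∄ =
      ⊕ₗ-bound-trivial xs! adm (λ z∈ → decidable-stable em λ z≉ε → ∄ (_ , z∈ , z≉ε)) n≤
    ... | yes (z , z∈zs , z≉ε) with em {P = ∃[ x ] (x ∈ xs × x ∙ z ∉ xs)}
    ...   | no ∄ = ⊕ₗ-bound-periodic x₀∈xs ε∈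
                     (λ x∈ → decidable-stable em λ x∙z∉ → ∄ (_ , x∈ , x∙z∉)) (ord≥ z∈zs z≉ε)
      where open Admissible adm
    ...   | yes (x , x∈xs , x∙z∉xs) =
      AtLeast-map {P = xs′ ⊕ₗ kept} (⊕ₗ-transform-⊆ commuting)
        (⊕ₗ-bound (rec (kept-shorter z∈zs x∙z∉xs)) (unique-xs′ xs! unique) (∈-++⁺ˡ setoid x₀∈xs)
                  (admissible-kept x∈xs adm)
                  (subst (λ k → n ≤ k ∸ 1) (≡-sym length-transform) n≤))
      where
      open Admissible adm
      open Transform x xs zs

    AtLeast⇒Unique∋ : ∀ {p} {P : Pred Carrier p} {n a} → AtLeast P n → P a →
                      ∃[ xs ] (Unique xs × All P xs × n ≤ length xs × a ∈ xs)
    AtLeast⇒Unique∋ {a = a} P≥n Pa with AtLeast⇒Unique P≥n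
    ... | xs , xs! , Pxs , refl with em {P = a ∈ xs}
    ...   | yes a∈xs = xs , xs! , Pxs , ≤-refl , a∈xs
    ...   | no a∉xs  = a ∷ xs , ∉⇒All[≉] setoid a∉xs ∷ xs! , Pa ∷ Pxs , n≤1+n _ , here ≈-refl

    ⊕-AtLeast : ∀ {p q} (X : Pred Carrier p) (Y : Pred Carrier q) → NonEmpty X → Commutative ⟨ Y ⟩ →
                (n : ℕ) → ωAtLeast Y n → SumAtLeast X Y n → AtLeast (X ⊕ Y) n
    ⊕-AtLeast X Y _ _ _ (inj₁ refl) _ = AtLeast-zero {P = X ⊕ Y}
    ⊕-AtLeast X Y (x₀ , Xx₀) comm n (inj₂ (y₀ , Yy₀ , inf)) (a , b , X≥a , Y≥b , n≤)
      with AtLeast⇒Unique∋ X≥a Xx₀ | AtLeast⇒Unique∋ Y≥b Yy₀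
    ... | xs , xs! , Xxs , a≤ , x₀∈xs | ys , ys! , Yys , b≤ , y₀∈ys =
      AtLeast-image {P = xs ⊕ₗ map (_∙ y₀ ⁻¹) ys} {Q = X ⊕ Y} (_∙ y₀) (∙-cancelʳ y₀ _ _) shift
        (⊕ₗ-bound (<-wellFounded _) xs! x₀∈xs
                  (differences-admissible ys! Yys y₀∈ys Yy₀ comm inf) n≤′)
      where
      n≤′ : n ≤ length xs + length (map (_∙ y₀ ⁻¹) ys) ∸ 1
      n≤′ = ≤-trans n≤ (∸-monoˡ-≤ 1 (+-mono-≤ a≤ (≤-trans b≤ (≤-reflexive (≡-sym (length-map _ ys))))))
      shift : ∀ {w} → (xs ⊕ₗ map (_∙ y₀ ⁻¹) ys) w → (X ⊕ Y) (w ∙ y₀)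
      shift {w} (x , z , x∈ , z∈ , w≈) with lookup≈ Xxs x∈ | ∈-differences Yys z∈
      ... | x′ , Xx′ , x≈x′ | y , Yy , z≈ = x′ , y , Xx′ , Yy , (begin
        w ∙ y₀                   ≈⟨ ∙-congʳ w≈ ⟩
        (x ∙ z) ∙ y₀             ≈⟨ ∙-congʳ (∙-cong x≈x′ z≈) ⟩
        (x′ ∙ (y ∙ y₀ ⁻¹)) ∙ y₀  ≈⟨ assoc x′ _ y₀ ⟩
        x′ ∙ ((y ∙ y₀ ⁻¹) ∙ y₀)  ≈⟨ ∙-congˡ (assoc y _ y₀) ⟩
        x′ ∙ (y ∙ (y₀ ⁻¹ ∙ y₀))  ≈⟨ ∙-congˡ (∙-congˡ (inverseˡ y₀)) ⟩
        x′ ∙ (y ∙ ε)             ≈⟨ ∙-congˡ (identityʳ y) ⟩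
        x′ ∙ y                   ∎)
        where open ≈-Reasoning

    module Extremal {q} (Y : Pred Carrier q) where

      _≼_ : Rel Carrier (c ⊔ ℓ ⊔ q)
      y ≼ y′ = InfAtLeast Y y ⊆′ InfAtLeast Y y′

      InfAtLeast-downward : ∀ {y} → Downward (InfAtLeast Y y)
      InfAtLeast-downward {y} m≤n inf w Yw w≉y = AtLeast-≤ {P = ⟨ ｛ w ∙ y ⁻¹ ｝ ⟩} m≤n (inf w Yw w≉y)

      InfAtLeast-resp-≈ : ∀ {y y′ n} → y ≈ y′ → InfAtLeast Y y n → InfAtLeast Y y′ n
      InfAtLeast-resp-≈ y≈y′ inf w Yw w≉y′ =
        OrdAtLeast-resp-≈ (∙-congˡ (⁻¹-cong y≈y′)) (inf w Yw λ w≈y → w≉y′ (trans w≈y y≈y′))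

      ≼-total : ∀ y y′ → y ≼ y′ ⊎ y′ ≼ y
      ≼-total y y′ = downward-total em InfAtLeast-downward InfAtLeast-downward

      representatives : ∀ bs → ∃[ ws ] (∀ {a} → Y a → a ∈ bs → Any (λ w → a ≈ proj₁ w) ws)
      representatives [] = [] , λ _ ()
      representatives (b ∷ bs) with representatives bs | em {P = ∃[ y ] (Y y × y ≈ b)}
      ... | ws , covered | yes (y , Yy , y≈b) = (y , Yy) ∷ ws , covered′
        where
        covered′ : ∀ {a} → Y a → a ∈ b ∷ bs → Any (λ w → a ≈ proj₁ w) ((y , Yy) ∷ ws)
        covered′ _ (here a≈b) = here (trans a≈b (sym y≈b))
        covered′ Ya (there a∈bs) = there (covered Ya a∈bs)
      ... | ws , covered | no ∄ = ws , covered′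
        where
        covered′ : ∀ {a} → Y a → a ∈ b ∷ bs → Any (λ w → a ≈ proj₁ w) ws
        covered′ Ya (here a≈b) = ⊥-elim (∄ (_ , Ya , a≈b))
        covered′ Ya (there a∈bs) = covered Ya a∈bs

      greatest : NonEmpty Y → Finite Y → ∃[ y₀ ] (Y y₀ × ∀ y₁ → Y y₁ → y₁ ≼ y₀)
      greatest (y , Yy) (bs , cover) with representatives bs
      ... | ws , represented
        with ∃-greatest {_≲_ = _≼_ on proj₁} (λ _ inf → inf) (λ ≼₁ ≼₂ n inf → ≼₂ n (≼₁ n inf))
                        (λ u v → ≼-total (proj₁ u) (proj₁ v)) (y , Yy) ws
      ... | (y₀ , Yy₀) , bounded = y₀ , Yy₀ , below
        where
        below : ∀ y₁ → Y y₁ → y₁ ≼ y₀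
        below y₁ Yy₁ n inf with All.lookupAny bounded (there (represented Yy₁ (cover Yy₁)))
        ... | w≼y₀ , y₁≈w = w≼y₀ n (InfAtLeast-resp-≈ y₁≈w inf)

      ω-attained : NonEmpty Y → Finite Y →
                   ∃[ y₀ ] (Y y₀ × (∀ y₁ → Y y₁ → y₁ ≼ y₀)
                            × (∀ n → ωAtLeast Y n ⇔ InfAtLeast Y y₀ n))
      ω-attained neY finY with greatest neY finY
      ... | y₀ , Yy₀ , y₀-greatest =
        y₀ , Yy₀ , y₀-greatest , λ n → mk⇔ (ω⇒inf n) (λ inf → inj₂ (y₀ , Yy₀ , inf))
        where
        ω⇒inf : ∀ n → ωAtLeast Y n → InfAtLeast Y y₀ n
        ω⇒inf _ (inj₁ refl) w _ _ = AtLeast-zero {P = ⟨ ｛ w ∙ y₀ ⁻¹ ｝ ⟩}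
        ω⇒inf n (inj₂ (y₁ , Yy₁ , inf)) = y₀-greatest y₁ Yy₁ n inf

corollary2p6 : (em : ∀ {a} → ExcludedMiddle a) →
    ∀ {c ℓ p q} (G : Group c ℓ) →
    let open Group G using (Carrier)
        open GroupDefs G
    in (X : Pred Carrier p) (Y : Pred Carrier q) →
       NonEmpty X → NonEmpty Y → Commutative ⟨ Y ⟩ →
       ((n : ℕ) → ωAtLeast Y n → SumAtLeast X Y n → AtLeast (X ⊕ Y) n)
       × (Finite Y →
            ∃[ y₀ ] (Y y₀
                     × (∀ y₁ → Y y₁ → ∀ n → InfAtLeast Y y₁ n → InfAtLeast Y y₀ n)
                     × (∀ n → ωAtLeast Y n ⇔ InfAtLeast Y y₀ n)))
corollary2p6 em G X Y neX neY comm = ⊕-AtLeast X Y neX comm , ω-attained neY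
  where
  open Sumsets.WithExcludedMiddle G em using (⊕-AtLeast; module Extremal)
  open Extremal Y using (ω-attained)
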